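{- Let $\mathfrak{M}$ be a computable graph machine whose vertex set $G$ is finite. Let $\mathbf{h}$ be the map on valid configurations $f$ of $\mathfrak{M}$ with $\mathbf{h}(f)=n$ if the run $\langle\mathfrak{M},f\rangle$ halts at stage $n$ and at no earlier stage, and $\mathbf{h}(f)=\infty$ if the run never halts. Then: (i) for every valid configuration $f$, the run $\langle\mathfrak{M},f\rangle$ is computable; (ii) $\mathbf{h}$ is computable.
   Context: Notation. $\mathfrak{P}_{<\omega}(Y)$ denotes the set of finite subsets of $Y$. For a tuple-valued function $f$, $f_{[k]}$ denotes its $k$-th coordinate. Colored graphs. A colored graph is $\mathcal{G}=(G,(L,V),(C,E),\gamma)$ with vertex set $G$, label set $L$, labeling $V\colon G\to L$, color set $C$, edge coloring $E\colon G\times G\to\mathfrak{P}_{<\omega}(C)$, and $\gamma\colon L\to\mathfrak{P}_{<\omega}(C)$ with $E(v,w)\subseteq\gamma(V(v))\cap\gamma(V(w))$. Graph machines. A graph machine is $\mathfrak{M}=(\mathcal{G},(\mathfrak{A},\{0,1\}),(S,s,\alpha),T)$ with: - a finite alphabet $\mathfrak{A}\ni0,1$; - a countable state set $S$; - a state assignment $\alpha\colon L\to\mathfrak{P}_{<\omega}(S)$; - an initial state $s\in\alpha(\ell)$ for all $\ell$; - a lookup table $T\colon L\times\mathfrak{P}_{<\omega}(C)\times\mathfrak{A}\times S\to\mathfrak{P}_{<\omega}(C)\times\mathfrak{A}\times S$. The lookup table satisfies three conditions: - $T(\ell,c,z,t)=(c,z,t)$ if $c\not\subseteq\gamma(\ell)$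 or $t\notin\alpha(\ell)$; - when $c\subseteq\gamma(\ell)$ and $t\in\alpha(\ell)$, $T_{[1]}(\ell,c,z,t)\subseteq\gamma(\ell)$ and $T_{[3]}(\ell,c,z,t)\in\alpha(\ell)$; - $T(\ell,\emptyset,0,s)=(\emptyset,0,s)$. The machine is computable if $G,L,C,S$ are computable sets (subsets of $\mathbb{N}$ up to standard coding) and $V,E,\gamma,\alpha,T$ are computable. Configurations and runs. A valid configuration is $f\colon G\to\mathfrak{P}_{<\omega}(C)\times\mathfrak{A}\times S$ with $f_{[1]}(v)\subseteq\gamma(V(v))$ and $f_{[3]}(v)\in\alpha(V(v))$. The run is given by $\langle\mathfrak{M},f\rangle(v,0)=f(v)$ and $\langle\mathfrak{M},f\rangle(v,n+1)=T(V(v),X,z,t)$, where $z,t$ are the 2nd and 3rd coordinates of $\langle\mathfrak{M},f\rangle(v,n)$ and $X=\bigcup_{w\in G}(E(w,v)\cap\langle\mathfrak{M},f\rangle_{[1]}(w,n))$. The run halts at stage $n$ if $\langle\mathfrak{M},f\rangle(v,n)=\langle\mathfrak{M},f\rangle(v,n+1)$ for all $v\in G$. -}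

module Defs where

open import Data.Nat using (ℕ; zero; suc; _+_; _*_; _∸_; _^_; _≤_; _<_; ⌊_/2⌋; _%_; _≡ᵇ_)
open import Data.Bool using (Bool; true; false; _∨_; _∧_; if_then_else_)
open import Data.Fin using (Fin)
open import Data.Vec using (Vec; []; _∷_; lookup)
open import Data.List using (List; []; _∷_; map; foldr)
open import Data.List.Membership.Propositional using (_∈_)
open import Data.Product using (Σ; ∃; _×_; _,_; proj₁; proj₂)
open import Data.Sum using (_⊎_)
open import Relation.Binary.PropositionalEquality using (_≡_)
open import Relation.Nullary using (¬_)
open import Function.Bundles using (_⇔_)

pair : ℕ → ℕ → ℕ
pair x y = 2 ^ x * suc (2 * y) ∸ 1

code3 : ℕ × ℕ × ℕ → ℕ
code3 (c , z , t) = pair c (pair z t)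

code4 : ℕ → ℕ → ℕ → ℕ → ℕ
code4 a b c d = pair a (pair b (pair c d))

listCode : List ℕ → ℕ
listCode [] = 0
listCode (x ∷ xs) = suc (pair x (listCode xs))

-- Finite subsets of ℕ, coded canonically as bit sets:
-- i belongs to the set with code c iff bit i of c is 1.

isOdd : ℕ → Bool
isOdd n = n % 2 ≡ᵇ 1

testBit : ℕ → ℕ → Bool
testBit c zero = isOdd c
testBit c (suc i) = testBit ⌊ c /2⌋ i

_∈ₛ_ : ℕ → ℕ → Set
i ∈ₛ c = testBit c i ≡ true

_⊆ₛ_ : ℕ → ℕ → Set
c ⊆ₛ d = ∀ i → i ∈ₛ c → i ∈ₛ d

∅ₛ : ℕ
∅ₛ = 0

bitVal : Bool → ℕ
bitVal b = if b then 1 else 0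

-- bitwise operation with fuel (fuel m + n suffices)
bitwiseF : (Bool → Bool → Bool) → ℕ → ℕ → ℕ → ℕ
bitwiseF op zero m n = 0
bitwiseF op (suc k) m n = bitVal (op (isOdd m) (isOdd n)) + 2 * bitwiseF op k ⌊ m /2⌋ ⌊ n /2⌋

_∪ₛ_ : ℕ → ℕ → ℕ
m ∪ₛ n = bitwiseF _∨_ (m + n) m n

_∩ₛ_ : ℕ → ℕ → ℕ
m ∩ₛ n = bitwiseF _∧_ (m + n) m n

⋃ₛ : List ℕ → ℕ
⋃ₛ = foldr _∪ₛ_ ∅ₛ

data PR : ℕ → Set where
  zer  : ∀ {n} → PR n
  succ : PR 1
  proj : ∀ {n} → Fin n → PR n
  comp : ∀ {m n} → PR m → Vec (PR n) m → PR n
  prec : ∀ {n} → PR n → PR (suc (suc n)) → PR (suc n)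
  mu   : ∀ {n} → PR (suc n) → PR n

mutual
  data _[_]⇓_ : ∀ {n} → PR n → Vec ℕ n → ℕ → Set where
    zer⇓  : ∀ {n} {xs : Vec ℕ n} → zer [ xs ]⇓ 0
    succ⇓ : ∀ {x} → succ [ x ∷ [] ]⇓ suc x
    proj⇓ : ∀ {n} {xs : Vec ℕ n} (i : Fin n) → proj i [ xs ]⇓ lookup xs i
    comp⇓ : ∀ {m n} {f : PR m} {gs : Vec (PR n) m} {xs ys y} →
            gs [ xs ]⇓* ys → f [ ys ]⇓ y → comp f gs [ xs ]⇓ y
    prec0⇓ : ∀ {n} {g : PR n} {h} {xs y} →
             g [ xs ]⇓ y → prec g h [ 0 ∷ xs ]⇓ y
    precS⇓ : ∀ {n} {g : PR n} {h} {xs k r y} →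
             prec g h [ k ∷ xs ]⇓ r → h [ k ∷ r ∷ xs ]⇓ y →
             prec g h [ suc k ∷ xs ]⇓ y
    mu⇓ : ∀ {n} {f : PR (suc n)} {xs y} →
          f [ y ∷ xs ]⇓ 0 →
          (∀ k → k < y → Σ ℕ λ m → f [ k ∷ xs ]⇓ suc m) →
          mu f [ xs ]⇓ y

  data _[_]⇓*_ : ∀ {m n} → Vec (PR n) m → Vec ℕ n → Vec ℕ m → Set where
    []⇓ : ∀ {n} {xs : Vec ℕ n} → [] [ xs ]⇓* []
    ∷⇓  : ∀ {m n} {g : PR n} {gs : Vec (PR n) m} {xs y ys} →
          g [ xs ]⇓ y → gs [ xs ]⇓* ys → (g ∷ gs) [ xs ]⇓* (y ∷ ys)

ComputableOn : (ℕ → Set) → (ℕ → ℕ) → Set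
ComputableOn D f = Σ (PR 1) λ e → ∀ x → D x → e [ x ∷ [] ]⇓ f x

ComputableSet : (ℕ → Bool) → Set
ComputableSet P = Σ (PR 1) λ e → ∀ x → e [ x ∷ [] ]⇓ bitVal (P x)

-- Finite sets of
-- colours / states are coded canonically as bit sets (see above).
-- The alphabet is {0, …, a-1} with a ≥ 2 (so it contains 0 and 1).

record GraphMachine : Set where
  field
    G L C S : ℕ → Bool
    V  : ℕ → ℕ            -- labelling (meaningful on G)
    E  : ℕ → ℕ → ℕ        -- edge colouring (code of finite subset of C)
    γ  : ℕ → ℕ            -- colours allowed at a label
    a  : ℕ
    α  : ℕ → ℕ            -- states allowed at a label
    s  : ℕ
    T  : ℕ → ℕ → ℕ → ℕ → ℕ × ℕ × ℕ

    2≤a  : 2 ≤ a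
    V-L  : ∀ v → G v ≡ true → L (V v) ≡ true
    γ-C  : ∀ ℓ → L ℓ ≡ true → ∀ i → i ∈ₛ γ ℓ → C i ≡ true
    E-γ  : ∀ v w → G v ≡ true → G w ≡ true →
           ∀ i → i ∈ₛ E v w → (i ∈ₛ γ (V v)) × (i ∈ₛ γ (V w))
    α-S  : ∀ ℓ → L ℓ ≡ true → ∀ i → i ∈ₛ α ℓ → S i ≡ true
    s-S  : S s ≡ true
    s-α  : ∀ ℓ → L ℓ ≡ true → s ∈ₛ α ℓ

    T-range : ∀ ℓ c z t → L ℓ ≡ true → (∀ i → i ∈ₛ c → C i ≡ true) → z < a → S t ≡ true →
              (∀ i → i ∈ₛ proj₁ (T ℓ c z t) → C i ≡ true) ×
              (proj₁ (proj₂ (T ℓ c z t)) < a) ×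
              (S (proj₂ (proj₂ (T ℓ c z t))) ≡ true)
    T-inert : ∀ ℓ c z t → L ℓ ≡ true → (∀ i → i ∈ₛ c → C i ≡ true) → z < a → S t ≡ true →
              (¬ (c ⊆ₛ γ ℓ) ⊎ ¬ (t ∈ₛ α ℓ)) → T ℓ c z t ≡ (c , z , t)
    T-local : ∀ ℓ c z t → L ℓ ≡ true → (∀ i → i ∈ₛ c → C i ≡ true) → z < a → S t ≡ true →
              c ⊆ₛ γ ℓ → t ∈ₛ α ℓ →
              (proj₁ (T ℓ c z t) ⊆ₛ γ ℓ) × (proj₂ (proj₂ (T ℓ c z t)) ∈ₛ α ℓ)
    T-quiet : ∀ ℓ → L ℓ ≡ true → T ℓ ∅ₛ 0 s ≡ (∅ₛ , 0 , s)

open GraphMachine public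

IsComputable : GraphMachine → Set
IsComputable M =
  ComputableSet (G M) × ComputableSet (L M) × ComputableSet (C M) × ComputableSet (S M) ×
  (Σ (PR 1) λ e → ∀ v → G M v ≡ true → e [ v ∷ [] ]⇓ V M v) ×
  (Σ (PR 1) λ e → ∀ v w → G M v ≡ true → G M w ≡ true → e [ pair v w ∷ [] ]⇓ E M v w) ×
  (Σ (PR 1) λ e → ∀ ℓ → L M ℓ ≡ true → e [ ℓ ∷ [] ]⇓ γ M ℓ) ×
  (Σ (PR 1) λ e → ∀ ℓ → L M ℓ ≡ true → e [ ℓ ∷ [] ]⇓ α M ℓ) ×
  (Σ (PR 1) λ e → ∀ ℓ c z t → L M ℓ ≡ true → (∀ i → i ∈ₛ c → C M i ≡ true) → z < a M → S M t ≡ true →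
       e [ code4 ℓ c z t ∷ [] ]⇓ code3 (T M ℓ c z t))

FiniteVertices : GraphMachine → Set
FiniteVertices M = Σ (List ℕ) λ gs → ∀ v → (G M v ≡ true) ⇔ (v ∈ gs)

Config : Set
Config = ℕ → ℕ × ℕ × ℕ

ValidConfig : GraphMachine → Config → Set
ValidConfig M f = ∀ v → G M v ≡ true →
  (proj₁ (f v) ⊆ₛ γ M (V M v)) × (proj₁ (proj₂ (f v)) < a M) × (proj₂ (proj₂ (f v)) ∈ₛ α M (V M v))

-- the run ⟨M,f⟩(v,n); the union over w ∈ G is taken over the finite
-- enumeration of G (the result does not depend on the enumeration)
run : (M : GraphMachine) → FiniteVertices M → Config → ℕ → Config
run M fin f zero v = f v
run M fin f (suc n) v =
  T M (V M v)
      (⋃ₛ (map (λ w → E M w v ∩ₛ proj₁ (run M fin f n w)) (proj₁ fin)))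
      (proj₁ (proj₂ (run M fin f n v)))
      (proj₂ (proj₂ (run M fin f n v)))

HaltsAt : (M : GraphMachine) → FiniteVertices M → Config → ℕ → Set
HaltsAt M fin f n = ∀ v → G M v ≡ true → run M fin f n v ≡ run M fin f (suc n) v

FirstHalt : (M : GraphMachine) → FiniteVertices M → Config → ℕ → Set
FirstHalt M fin f n = HaltsAt M fin f n × (∀ m → m < n → ¬ HaltsAt M fin f m)

RunComputable : (M : GraphMachine) → FiniteVertices M → Config → Set
RunComputable M fin f =
  Σ (PR 1) λ e → ∀ v n → G M v ≡ true → e [ pair v n ∷ [] ]⇓ code3 (run M fin f n v)

-- a natural number c codes the configuration f (on G): c is the code of a
-- list of entries pair v (code3 (f v)), containing every v ∈ G and only such
-- (in any order, possibly with repetitions)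
CodesConfig : GraphMachine → ℕ → Config → Set
CodesConfig M c f = Σ (List ℕ) λ vs →
  (c ≡ listCode (map (λ v → pair v (code3 (f v))) vs)) × (∀ v → (G M v ≡ true) ⇔ (v ∈ vs))

-- (ii) 𝐡 : valid configurations → ℕ ∪ {∞} is computable: a program which,
-- on any code of a valid configuration f, halts with output n iff 𝐡(f) = n,
-- and hence diverges iff 𝐡(f) = ∞
HaltingTimeComputable : (M : GraphMachine) → FiniteVertices M → Set
HaltingTimeComputable M fin =
  Σ (PR 1) λ e → ∀ f → ValidConfig M f → ∀ c → CodesConfig M c f →
    ∀ n → (e [ c ∷ [] ]⇓ n) ⇔ FirstHalt M fin f n

{-# OPTIONS --safe #-}
module Submission where

-- Because G is finite, a configuration restricted to G is a finite object, coded as the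
-- association list of the pairs (v , code3 (f v)) over a fixed enumeration of G.  One step of
-- the machine is then computable: the new entry at v is T applied to the label V v, the union
-- over w ∈ G of E w v ∩ (colours at w), and the symbol and state at v.  The finitely many values
-- of V and E on G are hard-wired into the program as constants, so only the program for T is
-- needed.  Iterating the step by primitive recursion computes the run (i).  As the coding is
-- injective, the run halts at stage n iff the codes of stages n and n + 1 agree, so the halting
-- time is the least such n, found by unbounded minimisation (ii).

open import Defs
open import Data.Nat using (ℕ; zero; suc; _+_; _*_; _∸_; _^_; _<_; ⌊_/2⌋; _≡ᵇ_; pred; s≤s)
open import Data.Nat.Properties
  using (<-cmp; suc-injective; +-suc; +-comm; *-suc; *-assoc; *-distribˡ-+; +-assoc; +-identityʳ;
         ^-distribˡ-+-*; pred[m∸n]≡m∸[1+n]; suc-pred; m*n≢0; m^n≢0; m≤n⇒∃[o]m+o≡n; ≡ᵇ⇒≡; ≡⇒≡ᵇ; _≟_)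
open import Data.Bool using (Bool; true; false; not; _∨_; _∧_)
import Data.Bool as Bool
open import Data.Fin using () renaming (zero to fzero; suc to fsuc)
open import Data.Vec using (Vec; []; _∷_)
open import Data.List using (List; []; _∷_; map; foldr; drop)
open import Data.List.Properties using (drop-map; drop-drop; map-cong-local)
open import Data.List.Relation.Unary.All using (tabulate)
open import Data.List.Relation.Unary.Any using (here; there)
open import Data.List.Membership.Propositional using (_∈_)
open import Data.Product using (∃-syntax; _×_; _,_; proj₁; proj₂)
open import Data.Sum using (_⊎_; inj₁; inj₂)
open import Data.Unit using (tt)
open import Data.Empty using (⊥-elim)
open import Function using (_∘_)
open import Function.Bundles using (_⇔_; mk⇔; Equivalence)
open import Relation.Binary.PropositionalEquality using (_≡_; _≢_; refl; sym; trans; cong; cong₂; subst; module ≡-Reasoning)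
open import Relation.Binary.Definitions using (tri<; tri≈; tri>)
open import Relation.Nullary using (¬_; yes; no)

mutual
  ⇓-functional : ∀ {n} {e : PR n} {xs y y′} → e [ xs ]⇓ y → e [ xs ]⇓ y′ → y ≡ y′
  ⇓-functional zer⇓ zer⇓ = refl
  ⇓-functional succ⇓ succ⇓ = refl
  ⇓-functional (proj⇓ i) (proj⇓ .i) = refl
  ⇓-functional (comp⇓ gs⇓ f⇓) (comp⇓ gs⇓′ f⇓′) with ⇓*-functional gs⇓ gs⇓′
  ... | refl = ⇓-functional f⇓ f⇓′
  ⇓-functional (prec0⇓ g⇓) (prec0⇓ g⇓′) = ⇓-functional g⇓ g⇓′
  ⇓-functional (precS⇓ r⇓ h⇓) (precS⇓ r⇓′ h⇓′) with ⇓-functional r⇓ r⇓′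
  ... | refl = ⇓-functional h⇓ h⇓′
  ⇓-functional (mu⇓ {y = y} zero⇓ before) (mu⇓ {y = y′} zero⇓′ before′) with <-cmp y y′
  ... | tri≈ _ y≡y′ _ = y≡y′
  ... | tri< y<y′ _ _ with () ← ⇓-functional zero⇓ (proj₂ (before′ y y<y′))
  ... | tri> _ _ y′<y with () ← ⇓-functional zero⇓′ (proj₂ (before y′ y′<y))

  ⇓*-functional : ∀ {m n} {gs : Vec (PR n) m} {xs ys ys′} → gs [ xs ]⇓* ys → gs [ xs ]⇓* ys′ → ys ≡ ys′
  ⇓*-functional []⇓ []⇓ = refl
  ⇓*-functional (∷⇓ g⇓ gs⇓) (∷⇓ g⇓′ gs⇓′) =
    cong₂ _∷_ (⇓-functional g⇓ g⇓′) (⇓*-functional gs⇓ gs⇓′)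

⇓-cast : ∀ {n} {e : PR n} {xs y y′} → y ≡ y′ → e [ xs ]⇓ y → e [ xs ]⇓ y′
⇓-cast refl e⇓ = e⇓

π₀ : ∀ {n} → PR (suc n)
π₀ = proj fzero

π₁ : ∀ {n} → PR (suc (suc n))
π₁ = proj (fsuc fzero)

π₂ : ∀ {n} → PR (suc (suc (suc n)))
π₂ = proj (fsuc (fsuc fzero))

π₃ : ∀ {n} → PR (suc (suc (suc (suc n))))
π₃ = proj (fsuc (fsuc (fsuc fzero)))

infixr 9 _∙_
infix 30 _⟨_,_⟩

_∙_ : ∀ {n} → PR 1 → PR n → PR n
f ∙ g = comp f (g ∷ [])

_⟨_,_⟩ : ∀ {n} → PR 2 → PR n → PR n → PR n
f ⟨ g , h ⟩ = comp f (g ∷ h ∷ [])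

∙⇓ : ∀ {n} {f : PR 1} {g : PR n} {xs y z} → f [ y ∷ [] ]⇓ z → g [ xs ]⇓ y → (f ∙ g) [ xs ]⇓ z
∙⇓ f⇓ g⇓ = comp⇓ (∷⇓ g⇓ []⇓) f⇓

⟨,⟩⇓ : ∀ {n} {f : PR 2} {g h : PR n} {xs y₁ y₂ z} →
       f [ y₁ ∷ y₂ ∷ [] ]⇓ z → g [ xs ]⇓ y₁ → h [ xs ]⇓ y₂ → f ⟨ g , h ⟩ [ xs ]⇓ z
⟨,⟩⇓ f⇓ g⇓ h⇓ = comp⇓ (∷⇓ g⇓ (∷⇓ h⇓ []⇓)) f⇓

constant : ∀ {n} → ℕ → PR n
constant zero = zer
constant (suc c) = succ ∙ constant c

constant⇓ : ∀ {n} {xs : Vec ℕ n} c → constant c [ xs ]⇓ c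
constant⇓ zero = zer⇓
constant⇓ (suc c) = ∙⇓ succ⇓ (constant⇓ c)

prec⇓ : ∀ {n} {g : PR n} {h : PR (suc (suc n))} {xs} (F : ℕ → ℕ) →
        g [ xs ]⇓ F 0 → (∀ k → h [ k ∷ F k ∷ xs ]⇓ F (suc k)) → ∀ k → prec g h [ k ∷ xs ]⇓ F k
prec⇓ F g⇓ h⇓ zero = prec0⇓ g⇓
prec⇓ F g⇓ h⇓ (suc k) = precS⇓ (prec⇓ F g⇓ h⇓ k) (h⇓ k)

isZeroP : PR 1
isZeroP = prec (constant 1) zer

isZero⇓ : ∀ x → isZeroP [ x ∷ [] ]⇓ bitVal (x ≡ᵇ 0)
isZero⇓ zero = prec0⇓ (constant⇓ 1)
isZero⇓ (suc x) = precS⇓ (isZero⇓ x) zer⇓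

find : ∀ {n} → PR (suc n) → PR n
find t = mu (isZeroP ∙ t)

find⇓ : ∀ {n} {t : PR (suc n)} {xs y} →
        t [ y ∷ xs ]⇓ 1 → (∀ k → k < y → t [ k ∷ xs ]⇓ 0) → find t [ xs ]⇓ y
find⇓ hit misses = mu⇓ (∙⇓ (isZero⇓ 1) hit) (λ k k<y → 0 , ∙⇓ (isZero⇓ 0) (misses k k<y))

find⇓-inv : ∀ {n} {t : PR (suc n)} {xs y} (b : ℕ → Bool) → (∀ k → t [ k ∷ xs ]⇓ bitVal (b k)) →
            find t [ xs ]⇓ y → Bool.T (b y) × (∀ k → k < y → ¬ Bool.T (b k))
find⇓-inv {t = t} {xs} b t⇓ (mu⇓ hit misses) =
  zero-tested (⇓-functional hit (tested _)) ,
  λ k k<y → nonzero-tested (⇓-functional (proj₂ (misses k k<y)) (tested k))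
  where
  tested : ∀ k → (isZeroP ∙ t) [ k ∷ xs ]⇓ bitVal (bitVal (b k) ≡ᵇ 0)
  tested k = ∙⇓ (isZero⇓ _) (t⇓ k)

  zero-tested : ∀ {c} → 0 ≡ bitVal (bitVal c ≡ᵇ 0) → Bool.T c
  zero-tested {true} _ = tt

  nonzero-tested : ∀ {c m} → suc m ≡ bitVal (bitVal c ≡ᵇ 0) → ¬ Bool.T c
  nonzero-tested {true} () _

addP : PR 2
addP = prec π₀ (succ ∙ π₁)

add⇓ : ∀ x y → addP [ x ∷ y ∷ [] ]⇓ (x + y)
add⇓ x y = prec⇓ (_+ y) (proj⇓ _) (λ _ → ∙⇓ succ⇓ (proj⇓ _)) x

mulP : PR 2
mulP = prec zer (addP ⟨ π₂ , π₁ ⟩)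

mul⇓ : ∀ x y → mulP [ x ∷ y ∷ [] ]⇓ (x * y)
mul⇓ x y = prec⇓ (_* y) zer⇓ (λ k → ⟨,⟩⇓ (add⇓ y (k * y)) (proj⇓ _) (proj⇓ _)) x

pow2P : PR 1
pow2P = prec (constant 1) (mulP ⟨ constant 2 , π₁ ⟩)

pow2⇓ : ∀ x → pow2P [ x ∷ [] ]⇓ (2 ^ x)
pow2⇓ = prec⇓ (2 ^_) (constant⇓ 1) (λ k → ⟨,⟩⇓ (mul⇓ 2 (2 ^ k)) (constant⇓ 2) (proj⇓ _))

predP : PR 1
predP = prec zer π₀

pred⇓ : ∀ x → predP [ x ∷ [] ]⇓ pred x
pred⇓ = prec⇓ pred zer⇓ (λ _ → proj⇓ _)

monusP : PR 2
monusP = prec π₀ (predP ∙ π₁) ⟨ π₁ , π₀ ⟩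

monus⇓ : ∀ x y → monusP [ x ∷ y ∷ [] ]⇓ (x ∸ y)
monus⇓ x y = ⟨,⟩⇓ (prec⇓ (x ∸_) (proj⇓ _) decrement y) (proj⇓ _) (proj⇓ _)
  where
  decrement : ∀ k → (predP ∙ π₁) [ k ∷ x ∸ k ∷ x ∷ [] ]⇓ (x ∸ suc k)
  decrement k = ⇓-cast (pred[m∸n]≡m∸[1+n] x k) (∙⇓ (pred⇓ (x ∸ k)) (proj⇓ _))

eqP : PR 2
eqP = isZeroP ∙ addP ⟨ monusP ⟨ π₀ , π₁ ⟩ , monusP ⟨ π₁ , π₀ ⟩ ⟩

eq⇓ : ∀ x y → eqP [ x ∷ y ∷ [] ]⇓ bitVal (x ≡ᵇ y)
eq⇓ x y = ⇓-cast (cong bitVal (distance≡0 x y))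
  (∙⇓ (isZero⇓ _) (⟨,⟩⇓ (add⇓ _ _) (⟨,⟩⇓ (monus⇓ x y) (proj⇓ _) (proj⇓ _))
                                    (⟨,⟩⇓ (monus⇓ y x) (proj⇓ _) (proj⇓ _))))
  where
  distance≡0 : ∀ x y → ((x ∸ y) + (y ∸ x) ≡ᵇ 0) ≡ (x ≡ᵇ y)
  distance≡0 zero zero = refl
  distance≡0 zero (suc y) = refl
  distance≡0 (suc x) zero = refl
  distance≡0 (suc x) (suc y) = distance≡0 x y

eq⇓-≡ : ∀ {x y} → x ≡ y → eqP [ x ∷ y ∷ [] ]⇓ 1
eq⇓-≡ {x} {y} x≡y with x ≡ᵇ y | ≡⇒≡ᵇ x y x≡y | eq⇓ x y
... | true | _ | x≟y⇓ = x≟y⇓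

eq⇓-≢ : ∀ {x y} → x ≢ y → eqP [ x ∷ y ∷ [] ]⇓ 0
eq⇓-≢ {x} {y} x≢y with x ≡ᵇ y in x≟y | eq⇓ x y
... | true | _ = ⊥-elim (x≢y (≡ᵇ⇒≡ x y (subst Bool.T (sym x≟y) tt)))
... | false | x≟y⇓ = x≟y⇓

truthTableP₁ : (Bool → Bool) → PR 1
truthTableP₁ u = prec (constant (bitVal (u false))) (constant (bitVal (u true)))

truthTable₁⇓ : ∀ u b → truthTableP₁ u [ bitVal b ∷ [] ]⇓ bitVal (u b)
truthTable₁⇓ u false = prec0⇓ (constant⇓ _)
truthTable₁⇓ u true = precS⇓ (prec0⇓ (constant⇓ _)) (constant⇓ _)

truthTableP₂ : (Bool → Bool → Bool) → PR 2
truthTableP₂ op = prec (truthTableP₁ (op false)) (truthTableP₁ (op true) ∙ π₂)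

truthTable₂⇓ : ∀ op b c → truthTableP₂ op [ bitVal b ∷ bitVal c ∷ [] ]⇓ bitVal (op b c)
truthTable₂⇓ op false c = prec0⇓ (truthTable₁⇓ (op false) c)
truthTable₂⇓ op true c = precS⇓ (prec0⇓ (truthTable₁⇓ (op false) c)) (∙⇓ (truthTable₁⇓ (op true) c) (proj⇓ _))

isOdd-suc : ∀ n → isOdd (suc n) ≡ not (isOdd n)
isOdd-suc zero = refl
isOdd-suc (suc zero) = refl
isOdd-suc (suc (suc n)) = isOdd-suc n

⌊suc-n/2⌋≡⌊n/2⌋+isOdd : ∀ n → ⌊ suc n /2⌋ ≡ ⌊ n /2⌋ + bitVal (isOdd n)
⌊suc-n/2⌋≡⌊n/2⌋+isOdd zero = refl
⌊suc-n/2⌋≡⌊n/2⌋+isOdd (suc zero) = refl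
⌊suc-n/2⌋≡⌊n/2⌋+isOdd (suc (suc n)) = cong suc (⌊suc-n/2⌋≡⌊n/2⌋+isOdd n)

isOdd[bit+2*r]≡bit : ∀ b r → isOdd (bitVal b + 2 * r) ≡ b
isOdd[bit+2*r]≡bit false zero = refl
isOdd[bit+2*r]≡bit true zero = refl
isOdd[bit+2*r]≡bit b (suc r)
  rewrite *-suc 2 r | +-suc (bitVal b) (suc (2 * r)) | +-suc (bitVal b) (2 * r) = isOdd[bit+2*r]≡bit b r

⌊bit+2*r/2⌋≡r : ∀ b r → ⌊ bitVal b + 2 * r /2⌋ ≡ r
⌊bit+2*r/2⌋≡r false zero = refl
⌊bit+2*r/2⌋≡r true zero = refl
⌊bit+2*r/2⌋≡r b (suc r)
  rewrite *-suc 2 r | +-suc (bitVal b) (suc (2 * r)) | +-suc (bitVal b) (2 * r) = cong suc (⌊bit+2*r/2⌋≡r b r)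

parityP : PR 1
parityP = prec zer (truthTableP₁ not ∙ π₁)

parity⇓ : ∀ x → parityP [ x ∷ [] ]⇓ bitVal (isOdd x)
parity⇓ = prec⇓ (bitVal ∘ isOdd) zer⇓
  (λ k → ⇓-cast (cong bitVal (sym (isOdd-suc k))) (∙⇓ (truthTable₁⇓ not (isOdd k)) (proj⇓ _)))

halfP : PR 1
halfP = prec zer (addP ⟨ π₁ , parityP ∙ π₀ ⟩)

half⇓ : ∀ x → halfP [ x ∷ [] ]⇓ ⌊ x /2⌋
half⇓ = prec⇓ ⌊_/2⌋ zer⇓
  (λ k → ⇓-cast (sym (⌊suc-n/2⌋≡⌊n/2⌋+isOdd k)) (⟨,⟩⇓ (add⇓ _ _) (proj⇓ _) (∙⇓ (parity⇓ k) (proj⇓ _))))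

⌊_/2^_⌋ : ℕ → ℕ → ℕ
⌊ m /2^ zero ⌋ = m
⌊ m /2^ suc j ⌋ = ⌊ ⌊ m /2^ j ⌋ /2⌋

⌊m/2^[1+j]⌋≡⌊⌊m/2⌋/2^j⌋ : ∀ m j → ⌊ m /2^ suc j ⌋ ≡ ⌊ ⌊ m /2⌋ /2^ j ⌋
⌊m/2^[1+j]⌋≡⌊⌊m/2⌋/2^j⌋ m zero = refl
⌊m/2^[1+j]⌋≡⌊⌊m/2⌋/2^j⌋ m (suc j) = cong ⌊_/2⌋ (⌊m/2^[1+j]⌋≡⌊⌊m/2⌋/2^j⌋ m j)

⌊2^j*q/2^j⌋≡q : ∀ j q → ⌊ 2 ^ j * q /2^ j ⌋ ≡ q
⌊2^j*q/2^j⌋≡q zero q = +-identityʳ q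
⌊2^j*q/2^j⌋≡q (suc j) q = begin
  ⌊ 2 * 2 ^ j * q /2^ suc j ⌋     ≡⟨ cong ⌊_/2^ suc j ⌋ (*-assoc 2 (2 ^ j) q) ⟩
  ⌊ 2 * (2 ^ j * q) /2^ suc j ⌋   ≡⟨ ⌊m/2^[1+j]⌋≡⌊⌊m/2⌋/2^j⌋ (2 * (2 ^ j * q)) j ⟩
  ⌊ ⌊ 2 * (2 ^ j * q) /2⌋ /2^ j ⌋ ≡⟨ cong ⌊_/2^ j ⌋ (⌊bit+2*r/2⌋≡r false (2 ^ j * q)) ⟩
  ⌊ 2 ^ j * q /2^ j ⌋             ≡⟨ ⌊2^j*q/2^j⌋≡q j q ⟩
  q                               ∎
  where open ≡-Reasoning

shiftP : PR 2
shiftP = prec π₀ (halfP ∙ π₁)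

shift⇓ : ∀ j m → shiftP [ j ∷ m ∷ [] ]⇓ ⌊ m /2^ j ⌋
shift⇓ j m = prec⇓ ⌊ m /2^_⌋ (proj⇓ _) (λ k → ∙⇓ (half⇓ _) (proj⇓ _)) j

bitwiseF-suc : ∀ op k m n → bitwiseF op (suc k) m n ≡
               bitwiseF op k m n + 2 ^ k * bitVal (op (isOdd ⌊ m /2^ k ⌋) (isOdd ⌊ n /2^ k ⌋))
bitwiseF-suc op zero m n = refl
bitwiseF-suc op (suc k) m n = begin
  b₀ + 2 * bitwiseF op (suc k) ⌊ m /2⌋ ⌊ n /2⌋      ≡⟨ cong (λ r → b₀ + 2 * r) (bitwiseF-suc op k ⌊ m /2⌋ ⌊ n /2⌋) ⟩
  b₀ + 2 * (r + 2 ^ k * b)                          ≡⟨ cong (b₀ +_) (*-distribˡ-+ 2 r (2 ^ k * b)) ⟩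
  b₀ + (2 * r + 2 * (2 ^ k * b))                    ≡⟨ sym (+-assoc b₀ (2 * r) _) ⟩
  bitwiseF op (suc k) m n + 2 * (2 ^ k * b)         ≡⟨ cong (bitwiseF op (suc k) m n +_) (sym (*-assoc 2 (2 ^ k) b)) ⟩
  bitwiseF op (suc k) m n + 2 ^ suc k * b           ≡⟨ cong (λ b → bitwiseF op (suc k) m n + 2 ^ suc k * b) b≡bitₖ ⟩
  bitwiseF op (suc k) m n + 2 ^ suc k * bitVal (op (isOdd ⌊ m /2^ suc k ⌋) (isOdd ⌊ n /2^ suc k ⌋)) ∎
  where
  open ≡-Reasoning
  b₀ r b : ℕ
  b₀ = bitVal (op (isOdd m) (isOdd n))
  r = bitwiseF op k ⌊ m /2⌋ ⌊ n /2⌋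
  b = bitVal (op (isOdd ⌊ ⌊ m /2⌋ /2^ k ⌋) (isOdd ⌊ ⌊ n /2⌋ /2^ k ⌋))
  b≡bitₖ : b ≡ bitVal (op (isOdd ⌊ m /2^ suc k ⌋) (isOdd ⌊ n /2^ suc k ⌋))
  b≡bitₖ = sym (cong₂ (λ m′ n′ → bitVal (op (isOdd m′) (isOdd n′)))
                      (⌊m/2^[1+j]⌋≡⌊⌊m/2⌋/2^j⌋ m k) (⌊m/2^[1+j]⌋≡⌊⌊m/2⌋/2^j⌋ n k))

-- bitwiseF recurses on shifted arguments; primitive recursion instead adds the k-th bit at weight 2 ^ k.
bitwiseP : (Bool → Bool → Bool) → PR 3
bitwiseP op = prec zer (addP ⟨ π₁ , mulP ⟨ pow2P ∙ π₀ , truthTableP₂ op ⟨ bitOf π₂ , bitOf π₃ ⟩ ⟩ ⟩)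
  where
  bitOf : PR 4 → PR 4
  bitOf x = parityP ∙ shiftP ⟨ π₀ , x ⟩

bitwise⇓ : ∀ op k m n → bitwiseP op [ k ∷ m ∷ n ∷ [] ]⇓ bitwiseF op k m n
bitwise⇓ op k m n = prec⇓ (λ j → bitwiseF op j m n) zer⇓ addBit k
  where
  addBit : ∀ j → _ [ j ∷ bitwiseF op j m n ∷ m ∷ n ∷ [] ]⇓ bitwiseF op (suc j) m n
  addBit j = ⇓-cast (sym (bitwiseF-suc op j m n))
    (⟨,⟩⇓ (add⇓ _ _) (proj⇓ _)
      (⟨,⟩⇓ (mul⇓ _ _) (∙⇓ (pow2⇓ j) (proj⇓ _))
        (⟨,⟩⇓ (truthTable₂⇓ op _ _)
          (∙⇓ (parity⇓ _) (⟨,⟩⇓ (shift⇓ j m) (proj⇓ _) (proj⇓ _)))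
          (∙⇓ (parity⇓ _) (⟨,⟩⇓ (shift⇓ j n) (proj⇓ _) (proj⇓ _))))))

setOpP : (Bool → Bool → Bool) → PR 2
setOpP op = comp (bitwiseP op) (addP ∷ π₀ ∷ π₁ ∷ [])

setOp⇓ : ∀ op m n → setOpP op [ m ∷ n ∷ [] ]⇓ bitwiseF op (m + n) m n
setOp⇓ op m n = comp⇓ (∷⇓ (add⇓ m n) (∷⇓ (proj⇓ _) (∷⇓ (proj⇓ _) []⇓))) (bitwise⇓ op (m + n) m n)

testBit-0 : ∀ i → testBit 0 i ≡ false
testBit-0 zero = refl
testBit-0 (suc i) = testBit-0 i

∉∅ₛ : ∀ i → ¬ i ∈ₛ ∅ₛ
∉∅ₛ i i∈∅ with () ← trans (sym i∈∅) (testBit-0 i)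

∈-bitwiseF : ∀ op k m n i → i ∈ₛ bitwiseF op k m n → op (testBit m i) (testBit n i) ≡ true
∈-bitwiseF op zero m n i i∈ = ⊥-elim (∉∅ₛ i i∈)
∈-bitwiseF op (suc k) m n zero i∈ = trans (sym (isOdd[bit+2*r]≡bit (op (isOdd m) (isOdd n)) r)) i∈
  where r = bitwiseF op k ⌊ m /2⌋ ⌊ n /2⌋
∈-bitwiseF op (suc k) m n (suc i) i∈ =
  ∈-bitwiseF op k ⌊ m /2⌋ ⌊ n /2⌋ i
    (trans (cong (λ c → testBit c i) (sym (⌊bit+2*r/2⌋≡r (op (isOdd m) (isOdd n)) r))) i∈)
  where r = bitwiseF op k ⌊ m /2⌋ ⌊ n /2⌋

∈-∪ₛ : ∀ m n i → i ∈ₛ (m ∪ₛ n) → i ∈ₛ m ⊎ i ∈ₛ n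
∈-∪ₛ m n i i∈ with testBit m i | testBit n i | ∈-bitwiseF _∨_ (m + n) m n i i∈
... | true | _ | _ = inj₁ refl
... | false | true | _ = inj₂ refl

∈-∩ₛ⁻ˡ : ∀ m n i → i ∈ₛ (m ∩ₛ n) → i ∈ₛ m
∈-∩ₛ⁻ˡ m n i i∈ with testBit m i | ∈-bitwiseF _∧_ (m + n) m n i i∈
... | true | _ = refl

∈-⋃ₛ : ∀ (g : ℕ → ℕ) ws i → i ∈ₛ ⋃ₛ (map g ws) → ∃[ w ] w ∈ ws × i ∈ₛ g w
∈-⋃ₛ g [] i i∈ = ⊥-elim (∉∅ₛ i i∈)
∈-⋃ₛ g (w ∷ ws) i i∈ with ∈-∪ₛ (g w) (⋃ₛ (map g ws)) i i∈
... | inj₁ i∈gw = w , here refl , i∈gw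
... | inj₂ i∈rest with ∈-⋃ₛ g ws i i∈rest
...   | w′ , w′∈ws , i∈gw′ = w′ , there w′∈ws , i∈gw′

suc-pair : ∀ x y → suc (pair x y) ≡ 2 ^ x * suc (2 * y)
suc-pair x y = suc-pred (2 ^ x * suc (2 * y)) {{m*n≢0 (2 ^ x) (suc (2 * y)) {{m^n≢0 2 x}}}}

isOdd⌊2^x*q/2^j⌋≡false : ∀ {j x} q → j < x → isOdd ⌊ 2 ^ x * q /2^ j ⌋ ≡ false
isOdd⌊2^x*q/2^j⌋≡false {j} {x} q j<x with o , 1+j+o≡x ← m≤n⇒∃[o]m+o≡n j<x = begin
  isOdd ⌊ 2 ^ x * q /2^ j ⌋                   ≡⟨ cong (λ x → isOdd ⌊ 2 ^ x * q /2^ j ⌋) x≡j+[1+o] ⟩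
  isOdd ⌊ 2 ^ (j + suc o) * q /2^ j ⌋         ≡⟨ cong (λ n → isOdd ⌊ n /2^ j ⌋) 2^[j+1+o]*q≡2^j*[2*[2^o*q]] ⟩
  isOdd ⌊ 2 ^ j * (2 * (2 ^ o * q)) /2^ j ⌋   ≡⟨ cong isOdd (⌊2^j*q/2^j⌋≡q j _) ⟩
  isOdd (2 * (2 ^ o * q))                     ≡⟨ isOdd[bit+2*r]≡bit false (2 ^ o * q) ⟩
  false                                       ∎
  where
  open ≡-Reasoning
  x≡j+[1+o] : x ≡ j + suc o
  x≡j+[1+o] = sym (trans (+-suc j o) 1+j+o≡x)
  2^[j+1+o]*q≡2^j*[2*[2^o*q]] : 2 ^ (j + suc o) * q ≡ 2 ^ j * (2 * (2 ^ o * q))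
  2^[j+1+o]*q≡2^j*[2*[2^o*q]] = trans (cong (_* q) (^-distribˡ-+-* 2 j (suc o)))
    (trans (*-assoc (2 ^ j) (2 ^ suc o) q) (cong (2 ^ j *_) (*-assoc 2 (2 ^ o) q)))

-- pair x y + 1 = 2 ^ x * (2 y + 1), so x is the position of the lowest set bit of pair x y + 1.
fstP : PR 1
fstP = find (parityP ∙ shiftP ⟨ π₀ , succ ∙ π₁ ⟩)

fst⇓ : ∀ x y → fstP [ pair x y ∷ [] ]⇓ x
fst⇓ x y = find⇓ (⇓-cast (cong bitVal lowest-bit) (bit⇓ x))
                 (λ k k<x → ⇓-cast (cong bitVal (lower-bit k<x)) (bit⇓ k))
  where
  bit⇓ : ∀ j → (parityP ∙ shiftP ⟨ π₀ , succ ∙ π₁ ⟩) [ j ∷ pair x y ∷ [] ]⇓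
               bitVal (isOdd ⌊ suc (pair x y) /2^ j ⌋)
  bit⇓ j = ∙⇓ (parity⇓ _) (⟨,⟩⇓ (shift⇓ j _) (proj⇓ _) (∙⇓ succ⇓ (proj⇓ _)))

  lowest-bit : isOdd ⌊ suc (pair x y) /2^ x ⌋ ≡ true
  lowest-bit rewrite suc-pair x y | ⌊2^j*q/2^j⌋≡q x (suc (2 * y)) = isOdd[bit+2*r]≡bit true y

  lower-bit : ∀ {j} → j < x → isOdd ⌊ suc (pair x y) /2^ j ⌋ ≡ false
  lower-bit j<x rewrite suc-pair x y = isOdd⌊2^x*q/2^j⌋≡false (suc (2 * y)) j<x

sndP : PR 1
sndP = halfP ∙ shiftP ⟨ fstP ∙ π₀ , succ ∙ π₀ ⟩

snd⇓ : ∀ x y → sndP [ pair x y ∷ [] ]⇓ y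
snd⇓ x y = ⇓-cast odd-part
  (∙⇓ (half⇓ _) (⟨,⟩⇓ (shift⇓ x _) (∙⇓ (fst⇓ x y) (proj⇓ _)) (∙⇓ succ⇓ (proj⇓ _))))
  where
  odd-part : ⌊ ⌊ suc (pair x y) /2^ x ⌋ /2⌋ ≡ y
  odd-part rewrite suc-pair x y | ⌊2^j*q/2^j⌋≡q x (suc (2 * y)) = ⌊bit+2*r/2⌋≡r true y

pair-injective : ∀ {x y x′ y′} → pair x y ≡ pair x′ y′ → x ≡ x′ × y ≡ y′
pair-injective {x} {y} {x′} {y′} eq =
  ⇓-functional (fst⇓ x y) (subst (λ c → fstP [ c ∷ [] ]⇓ x′) (sym eq) (fst⇓ x′ y′)) ,
  ⇓-functional (snd⇓ x y) (subst (λ c → sndP [ c ∷ [] ]⇓ y′) (sym eq) (snd⇓ x′ y′))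

pairP : PR 2
pairP = predP ∙ mulP ⟨ pow2P ∙ π₀ , succ ∙ mulP ⟨ constant 2 , π₁ ⟩ ⟩

pair⇓ : ∀ x y → pairP [ x ∷ y ∷ [] ]⇓ pair x y
pair⇓ x y = ∙⇓ (pred⇓ _)
  (⟨,⟩⇓ (mul⇓ _ _) (∙⇓ (pow2⇓ x) (proj⇓ _)) (∙⇓ succ⇓ (⟨,⟩⇓ (mul⇓ 2 y) (constant⇓ 2) (proj⇓ _))))

code3-injective : ∀ {r r′} → code3 r ≡ code3 r′ → r ≡ r′
code3-injective {c , z , t} {c′ , z′ , t′} eq
  with refl , eq′ ← pair-injective {c} {pair z t} {c′} {pair z′ t′} eq
  with refl , refl ← pair-injective {z} {t} {z′} {t′} eq′ = refl

assoc : (ℕ → ℕ) → List ℕ → ℕ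
assoc F vs = listCode (map (λ v → pair v (F v)) vs)

assoc-cong : ∀ F F′ ws → (∀ {w} → w ∈ ws → F w ≡ F′ w) → assoc F ws ≡ assoc F′ ws
assoc-cong F F′ ws F≡F′ =
  cong listCode (map-cong-local (tabulate (λ {w} w∈ws → cong (pair w) (F≡F′ w∈ws))))

assoc-injective : ∀ F F′ ws → assoc F ws ≡ assoc F′ ws → ∀ {w} → w ∈ ws → F w ≡ F′ w
assoc-injective F F′ (v ∷ ws) eq w∈
  with head≡ , tail≡ ← pair-injective {pair v (F v)} {assoc F ws} {pair v (F′ v)} {assoc F′ ws}
                                     (suc-injective eq)
     | w∈
... | here refl = proj₂ (pair-injective {v} {F v} {v} {F′ v} head≡)
... | there w∈ws = assoc-injective F F′ ws tail≡ w∈ws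

tailP : PR 1
tailP = sndP ∙ predP

-- The empty list is coded by 0 = pair 0 0, so its tail is itself, as with drop.
tail⇓ : ∀ cs → tailP [ listCode cs ∷ [] ]⇓ listCode (drop 1 cs)
tail⇓ [] = ∙⇓ (snd⇓ 0 0) (pred⇓ 0)
tail⇓ (c ∷ cs) = ∙⇓ (snd⇓ c (listCode cs)) (pred⇓ _)

dropP : PR 2
dropP = prec π₀ (tailP ∙ π₁)

drop⇓ : ∀ k cs → dropP [ k ∷ listCode cs ∷ [] ]⇓ listCode (drop k cs)
drop⇓ k cs = prec⇓ (λ j → listCode (drop j cs)) (proj⇓ _)
  (λ j → ⇓-cast (cong listCode (drop-suc j)) (∙⇓ (tail⇓ (drop j cs)) (proj⇓ _))) k
  where
  drop-suc : ∀ j → drop 1 (drop j cs) ≡ drop (suc j) cs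
  drop-suc j = trans (drop-drop j 1 cs) (cong (λ i → drop i cs) (+-comm j 1))

entryAtP : PR 2
entryAtP = fstP ∙ predP ∙ dropP

entryAt⇓ : ∀ F vs k {v rest} → drop k vs ≡ v ∷ rest → entryAtP [ k ∷ assoc F vs ∷ [] ]⇓ pair v (F v)
entryAt⇓ F vs k {v} {rest} dropₖ≡ =
  ∙⇓ (fst⇓ (entry v) (assoc F rest)) (∙⇓ (pred⇓ _) (⇓-cast (cong listCode dropped-entries) (drop⇓ k _)))
  where
  entry : ℕ → ℕ
  entry v = pair v (F v)
  dropped-entries : drop k (map entry vs) ≡ map entry (v ∷ rest)
  dropped-entries = trans (drop-map k vs) (cong (map entry) dropₖ≡)

first-occurrence : ∀ {v} vs → v ∈ vs →
  ∃[ i ] (∃[ rest ] drop i vs ≡ v ∷ rest) × (∀ k → k < i → ∃[ x ] ∃[ rest ] drop k vs ≡ x ∷ rest × x ≢ v)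
first-occurrence {v} (x ∷ vs) v∈ with x ≟ v | v∈
... | yes refl | _ = 0 , (vs , refl) , λ _ ()
... | no x≢v | here v≡x = ⊥-elim (x≢v (sym v≡x))
... | no x≢v | there v∈vs with i , hit , misses ← first-occurrence vs v∈vs = suc i , hit , earlier
  where
  earlier : ∀ k → k < suc i → ∃[ y ] ∃[ rest ] drop k (x ∷ vs) ≡ y ∷ rest × y ≢ v
  earlier zero _ = x , vs , refl , x≢v
  earlier (suc k) (s≤s k<i) = misses k k<i

keyTestP : PR 3
keyTestP = eqP ⟨ fstP ∙ entryAtP ⟨ π₀ , π₂ ⟩ , π₁ ⟩

lookupP : PR 2
lookupP = sndP ∙ entryAtP ⟨ find keyTestP , π₁ ⟩

lookup⇓ : ∀ F vs {v} → v ∈ vs → lookupP [ v ∷ assoc F vs ∷ [] ]⇓ F v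
lookup⇓ F vs {v} v∈vs with i , (_ , hit) , misses ← first-occurrence vs v∈vs =
  ∙⇓ (snd⇓ v (F v)) (⟨,⟩⇓ (entryAt⇓ F vs i hit) (find⇓ (keyTest hit (eq⇓-≡ refl)) miss) (proj⇓ _))
  where
  keyTest : ∀ {k x rest r} → drop k vs ≡ x ∷ rest → eqP [ x ∷ v ∷ [] ]⇓ r →
            keyTestP [ k ∷ v ∷ assoc F vs ∷ [] ]⇓ r
  keyTest {k} {x} dropₖ≡ x≟v⇓ =
    ⟨,⟩⇓ x≟v⇓ (∙⇓ (fst⇓ x (F x)) (⟨,⟩⇓ (entryAt⇓ F vs k dropₖ≡) (proj⇓ _) (proj⇓ _))) (proj⇓ _)

  miss : ∀ k → k < i → keyTestP [ k ∷ v ∷ assoc F vs ∷ [] ]⇓ 0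
  miss k k<i with _ , _ , dropₖ≡ , x≢v ← misses k k<i = keyTest dropₖ≡ (eq⇓-≢ x≢v)

foldrP : ∀ {n} → PR 2 → PR n → List ℕ → (ℕ → PR n) → PR n
foldrP f e [] p = e
foldrP f e (w ∷ ws) p = f ⟨ p w , foldrP f e ws p ⟩

foldr⇓ : ∀ {n} {f : PR 2} {e : PR n} {xs} {_⊕_ : ℕ → ℕ → ℕ} {z} →
         (∀ a b → f [ a ∷ b ∷ [] ]⇓ (a ⊕ b)) → e [ xs ]⇓ z →
         ∀ F ws {p : ℕ → PR n} → (∀ {w} → w ∈ ws → p w [ xs ]⇓ F w) →
         foldrP f e ws p [ xs ]⇓ foldr _⊕_ z (map F ws)
foldr⇓ f⇓ e⇓ F [] p⇓ = e⇓
foldr⇓ f⇓ e⇓ F (w ∷ ws) p⇓ = ⟨,⟩⇓ (f⇓ _ _) (p⇓ (here refl)) (foldr⇓ f⇓ e⇓ F ws (p⇓ ∘ there))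

listCode-foldr : ∀ cs → foldr (λ c l → suc (pair c l)) 0 cs ≡ listCode cs
listCode-foldr [] = refl
listCode-foldr (c ∷ cs) = cong (suc ∘ pair c) (listCode-foldr cs)

assocP : ∀ {n} → List ℕ → (ℕ → PR n) → PR n
assocP ws p = foldrP (succ ∙ pairP) (constant 0) ws (λ w → pairP ⟨ constant w , p w ⟩)

assoc⇓ : ∀ {n} {xs : Vec ℕ n} F ws {p : ℕ → PR n} → (∀ {w} → w ∈ ws → p w [ xs ]⇓ F w) →
         assocP ws p [ xs ]⇓ assoc F ws
assoc⇓ F ws p⇓ = ⇓-cast (listCode-foldr _)
  (foldr⇓ (λ a b → ∙⇓ succ⇓ (pair⇓ a b)) (constant⇓ 0) (λ w → pair w (F w)) ws
    (λ {w} w∈ws → ⟨,⟩⇓ (pair⇓ w (F w)) (constant⇓ w) (p⇓ w∈ws)))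

module Dynamics (M : GraphMachine) (fin : FiniteVertices M) where

  vertices : List ℕ
  vertices = proj₁ fin

  ∈vertices⇒∈G : ∀ {v} → v ∈ vertices → G M v ≡ true
  ∈vertices⇒∈G {v} = Equivalence.from (proj₂ fin v)

  ∈G⇒∈vertices : ∀ {v} → G M v ≡ true → v ∈ vertices
  ∈G⇒∈vertices {v} = Equivalence.to (proj₂ fin v)

  incoming : Config → ℕ → ℕ
  incoming R v = ⋃ₛ (map (λ w → E M w v ∩ₛ proj₁ (R w)) vertices)

  -- run M fin f (suc n) is step (run M fin f n) by definition.
  step : Config → Config
  step R v = T M (V M v) (incoming R v) (proj₁ (proj₂ (R v))) (proj₂ (proj₂ (R v)))

  incoming⊆γ : ∀ R {v} → G M v ≡ true → incoming R v ⊆ₛ γ M (V M v)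
  incoming⊆γ R {v} v∈G i i∈X
    with w , w∈vertices , i∈Ewv∩ ← ∈-⋃ₛ (λ w → E M w v ∩ₛ proj₁ (R w)) vertices i i∈X =
    proj₂ (E-γ M w v (∈vertices⇒∈G w∈vertices) v∈G i (∈-∩ₛ⁻ˡ _ _ i i∈Ewv∩))

  step-in-domain : ∀ R → ValidConfig M R → ∀ {v} → G M v ≡ true →
    L M (V M v) ≡ true × (∀ i → i ∈ₛ incoming R v → C M i ≡ true) ×
    proj₁ (proj₂ (R v)) < a M × S M (proj₂ (proj₂ (R v))) ≡ true
  step-in-domain R valid {v} v∈G =
    ℓ∈L , (λ i i∈X → γ-C M (V M v) ℓ∈L i (incoming⊆γ R v∈G i i∈X)) ,
    proj₁ (proj₂ (valid v v∈G)) , α-S M (V M v) ℓ∈L _ (proj₂ (proj₂ (valid v v∈G)))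
    where
    ℓ∈L : L M (V M v) ≡ true
    ℓ∈L = V-L M v v∈G

  step-valid : ∀ R → ValidConfig M R → ValidConfig M (step R)
  step-valid R valid v v∈G with ℓ∈L , X⊆C , z<a , t∈S ← step-in-domain R valid v∈G =
    proj₁ local , proj₁ (proj₂ range) , proj₂ local
    where
    range = T-range M (V M v) (incoming R v) _ _ ℓ∈L X⊆C z<a t∈S
    local = T-local M (V M v) (incoming R v) _ _ ℓ∈L X⊆C z<a t∈S
                    (incoming⊆γ R v∈G) (proj₂ (proj₂ (valid v v∈G)))

  run-valid : ∀ {f} → ValidConfig M f → ∀ n → ValidConfig M (run M fin f n)
  run-valid valid zero = valid
  run-valid valid (suc n) = step-valid _ (run-valid valid n)

  code : Config → ℕ
  code R = assoc (code3 ∘ R) vertices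

  HaltsAt⇔code≡ : ∀ f n → HaltsAt M fin f n ⇔ (code (run M fin f n) ≡ code (run M fin f (suc n)))
  HaltsAt⇔code≡ f n = mk⇔
    (λ halts → assoc-cong now next vertices (λ w∈ → cong code3 (halts _ (∈vertices⇒∈G w∈))))
    (λ code≡ v v∈G → code3-injective (assoc-injective now next vertices code≡ (∈G⇒∈vertices v∈G)))
    where
    now next : ℕ → ℕ
    now = code3 ∘ run M fin f n
    next = code3 ∘ run M fin f (suc n)

module Simulation (M : GraphMachine) (fin : FiniteVertices M) (TP : PR 1)
  (T⇓ : ∀ ℓ c z t → L M ℓ ≡ true → (∀ i → i ∈ₛ c → C M i ≡ true) → z < a M → S M t ≡ true →
        TP [ code4 ℓ c z t ∷ [] ]⇓ code3 (T M ℓ c z t)) where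

  open Dynamics M fin

  entryP : ℕ → PR 1
  entryP v = lookupP ⟨ constant v , π₀ ⟩

  entry⇓ : ∀ R vs {v} → v ∈ vs → entryP v [ assoc (code3 ∘ R) vs ∷ [] ]⇓ code3 (R v)
  entry⇓ R vs v∈vs = ⟨,⟩⇓ (lookup⇓ (code3 ∘ R) vs v∈vs) (constant⇓ _) (proj⇓ _)

  colours⇓ : ∀ r → fstP [ code3 r ∷ [] ]⇓ proj₁ r
  colours⇓ (c , z , t) = fst⇓ c (pair z t)

  symbolAndState⇓ : ∀ r → sndP [ code3 r ∷ [] ]⇓ pair (proj₁ (proj₂ r)) (proj₂ (proj₂ r))
  symbolAndState⇓ (c , z , t) = snd⇓ c (pair z t)

  incomingP : ℕ → PR 1
  incomingP v =
    foldrP (setOpP _∨_) (constant ∅ₛ) vertices (λ w → setOpP _∧_ ⟨ constant (E M w v) , fstP ∙ entryP w ⟩)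

  incoming⇓ : ∀ R v → incomingP v [ code R ∷ [] ]⇓ incoming R v
  incoming⇓ R v = foldr⇓ (setOp⇓ _∨_) (constant⇓ ∅ₛ) (λ w → E M w v ∩ₛ proj₁ (R w)) vertices
    (λ {w} w∈ → ⟨,⟩⇓ (setOp⇓ _∧_ _ _) (constant⇓ _) (∙⇓ (colours⇓ (R w)) (entry⇓ R vertices w∈)))

  updateP : ℕ → PR 1
  updateP v = TP ∙ pairP ⟨ constant (V M v) , pairP ⟨ incomingP v , sndP ∙ entryP v ⟩ ⟩

  update⇓ : ∀ R → ValidConfig M R → ∀ {v} → v ∈ vertices → updateP v [ code R ∷ [] ]⇓ code3 (step R v)
  update⇓ R valid {v} v∈ with ℓ∈L , X⊆C , z<a , t∈S ← step-in-domain R valid (∈vertices⇒∈G v∈) =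
    ∙⇓ (T⇓ (V M v) (incoming R v) _ _ ℓ∈L X⊆C z<a t∈S)
       (⟨,⟩⇓ (pair⇓ _ _) (constant⇓ _)
         (⟨,⟩⇓ (pair⇓ _ _) (incoming⇓ R v) (∙⇓ (symbolAndState⇓ (R v)) (entry⇓ R vertices v∈))))

  stepP : PR 1
  stepP = assocP vertices updateP

  step⇓ : ∀ R → ValidConfig M R → stepP [ code R ∷ [] ]⇓ code (step R)
  step⇓ R valid = assoc⇓ (code3 ∘ step R) vertices (update⇓ R valid)

  runCodeP : PR 1 → PR 2
  runCodeP init = prec init (stepP ∙ π₁)

  runCode⇓ : ∀ {init} f {x} → ValidConfig M f → init [ x ∷ [] ]⇓ code f →
             ∀ k → runCodeP init [ k ∷ x ∷ [] ]⇓ code (run M fin f k)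
  runCode⇓ f valid init⇓ =
    prec⇓ (code ∘ run M fin f) init⇓ (λ k → ∙⇓ (step⇓ _ (run-valid valid k)) (proj⇓ _))

  run-computable : ∀ f → ValidConfig M f → RunComputable M fin f
  run-computable f valid =
    lookupP ⟨ fstP ∙ π₀ , runCodeP (constant (code f)) ⟨ sndP ∙ π₀ , π₀ ⟩ ⟩ ,
    λ v n v∈G → ⟨,⟩⇓ (lookup⇓ (code3 ∘ run M fin f n) vertices (∈G⇒∈vertices v∈G))
                     (∙⇓ (fst⇓ v n) (proj⇓ _))
                     (⟨,⟩⇓ (runCode⇓ f valid (constant⇓ _) n) (∙⇓ (snd⇓ v n) (proj⇓ _)) (proj⇓ _))

  -- The halting test compares codes, so an input code, which may list G in any order and with
  -- repetitions, is first rewritten in the order of vertices.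
  normaliseP : PR 1
  normaliseP = assocP vertices entryP

  normalise⇓ : ∀ {c} f → CodesConfig M c f → normaliseP [ c ∷ [] ]⇓ code f
  normalise⇓ f (vs , c≡ , covers) = subst (λ c → normaliseP [ c ∷ [] ]⇓ code f) (sym c≡)
    (assoc⇓ (code3 ∘ f) vertices (λ {v} v∈ → entry⇓ f vs (Equivalence.to (covers v) (∈vertices⇒∈G v∈))))

  haltTestP : PR 2
  haltTestP = eqP ⟨ runCodeP normaliseP , stepP ∙ runCodeP normaliseP ⟩

  module _ (f : Config) (valid : ValidConfig M f) (c : ℕ) (codes : CodesConfig M c f) where

    haltTest : ∀ {k r} → eqP [ code (run M fin f k) ∷ code (run M fin f (suc k)) ∷ [] ]⇓ r →
               haltTestP [ k ∷ c ∷ [] ]⇓ r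
    haltTest {k} eq⇓′ = ⟨,⟩⇓ eq⇓′ config⇓ (∙⇓ (step⇓ _ (run-valid valid k)) config⇓)
      where
      config⇓ : runCodeP normaliseP [ k ∷ c ∷ [] ]⇓ code (run M fin f k)
      config⇓ = runCode⇓ f valid (normalise⇓ f codes) k

    halts? : ℕ → Bool
    halts? k = code (run M fin f k) ≡ᵇ code (run M fin f (suc k))

    haltingTime-sound : ∀ {n} → find haltTestP [ c ∷ [] ]⇓ n → FirstHalt M fin f n
    haltingTime-sound {n} found
      with halts , misses ← find⇓-inv halts? (λ k → haltTest (eq⇓ _ _)) found =
      Equivalence.from (HaltsAt⇔code≡ f n) (≡ᵇ⇒≡ _ _ halts) ,
      λ m m<n haltsₘ → misses m m<n (≡⇒≡ᵇ _ _ (Equivalence.to (HaltsAt⇔code≡ f m) haltsₘ))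

    haltingTime-complete : ∀ {n} → FirstHalt M fin f n → find haltTestP [ c ∷ [] ]⇓ n
    haltingTime-complete {n} (halts , early) =
      find⇓ (haltTest (eq⇓-≡ (Equivalence.to (HaltsAt⇔code≡ f n) halts)))
            (λ k k<n → haltTest (eq⇓-≢ λ code≡ → early k k<n (Equivalence.from (HaltsAt⇔code≡ f k) code≡)))

  haltingTime-computable : HaltingTimeComputable M fin
  haltingTime-computable = find haltTestP ,
    λ f valid c codes n → mk⇔ (haltingTime-sound f valid c codes) (haltingTime-complete f valid c codes)

mainTheorem11 : (M : GraphMachine) → IsComputable M → (fin : FiniteVertices M) →
    (∀ f → ValidConfig M f → RunComputable M fin f) × HaltingTimeComputable M fin
mainTheorem11 M (_ , _ , _ , _ , _ , _ , _ , _ , TP , T⇓) fin = run-computable , haltingTime-computable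
  where open Simulation M fin TP T⇓
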